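{- Let $\Pi$ be a strongly $\lambda$-extendible property on oriented graphs, with $\lambda=\frac{1}{2}$, and suppose $\Pi$ is hereditary, the oriented triangle $\vec{K}_3\notin\Pi$, and the non-oriented triangle $\overset{\nrightarrow}{K}_3\in\Pi$. Then $\mathrm{ex}(K_j)>0$ for every integer $j\geq 2$ with $j\neq 3$.
   Context: Here the graph class $\mathcal{G}$ is the class of oriented graphs (simple graphs each of whose edges is given a direction), without labels; $U(G)$ is the underlying simple graph. The oriented triangle $\vec{K}_3$ is the directed 3-cycle; the non-oriented triangle $\overset{\nrightarrow}{K}_3$ is the transitive tournament on three vertices. A graph property $\Pi$ is a subset of $\mathcal{G}$ closed under isomorphism; it is hereditary if every vertex-induced subgraph of a graph in $\Pi$ is in $\Pi$. For $\lambda\in(0,1)$, $\Pi$ is strongly $\lambda$-extendible if: (inclusiveness) every $G\in\mathcal{G}$ with $U(G)\in\{K_1,K_2\}$ is in $\Pi$; (block additivity) $G\in\Pi$ iff every block of $G$ is in $\Pi$; (strong $\lambda$-subgraph extension) for every $G\in\mathcal{G}$ and every partition $(U,W)$ of $V(G)$ with $G[U],G[W]\in\Pi$, there is a set $F$ of edges between $U$ and $W$ with $|F|\geq\lambda|E(U,W)|$ such that $G-(E(U,W)\setminus F)\in\Pi$. For $G\in\mathcal{G}$, $\beta(G)$ is the maximum number of edges of a subgraph of $G$ in $\Pi$; $\beta(K_j)=\min\{\beta(G):G\in\mathcal{G},U(G)=K_j\}$ and $\mathrm{ex}(K_j)=\beta(K_j)-\big(\lambda\binom{j}{2}+\frac{1-\lambda}{2}(j-1)\big)$.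 -}

module Defs where

open import Data.Bool using (Bool; true; false; _∧_; _∨_; not; if_then_else_)
open import Data.Bool.Properties using (∧-zeroʳ)
open import Data.Nat using (ℕ; zero; suc; _+_; _∸_; _≤_)
open import Data.Nat.Combinatorics using (_C_)
open import Data.Fin using (Fin; zero; suc; _≟_)
open import Relation.Binary.PropositionalEquality using (setoid)
open import Data.Integer using (+_)
open import Data.Rational using (ℚ; _/_; 1ℚ) renaming (_≤_ to _≤ℚ_; _*_ to _*ℚ_; _+_ to _+ℚ_; _-_ to _-ℚ_)
open import Data.Product using (Σ; _×_; _,_; ∃)
open import Data.Sum using (_⊎_)
open import Data.Empty using (⊥)
open import Function using (_∘_)
open import Function.Bundles using (Bijection)
open import Function.Definitions using (Injective)
open import Relation.Nullary using (¬_)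
open import Relation.Nullary.Decidable using (⌊_⌋)
open import Relation.Binary.PropositionalEquality using (_≡_; refl; _≢_)

-- Oriented graphs on the vertex set Fin n.
-- arc i j ≡ true  means there is an edge directed from i to j.
-- Simple + oriented: no loops, and at most one direction per pair.

record OGraph (n : ℕ) : Set where
  field
    arc     : Fin n → Fin n → Bool
    irrefl  : ∀ i → arc i i ≡ false
    oriented : ∀ i j → arc i j ≡ true → arc j i ≡ false
open OGraph public

-- adjacency in the underlying simple graph U(G)
adj : ∀ {n} → OGraph n → Fin n → Fin n → Bool
adj G i j = arc G i j ∨ arc G j i

sumFin : ∀ {n} → (Fin n → ℕ) → ℕ
sumFin {zero}  f = 0
sumFin {suc n} f = f zero + sumFin (f ∘ suc)

b2n : Bool → ℕ
b2n true  = 1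
b2n false = 0

countPairs : ∀ {n} → (Fin n → Fin n → Bool) → ℕ
countPairs P = sumFin (λ i → sumFin (λ j → b2n (P i j)))

-- |E(G)| : every edge is counted once (as its unique arc)
edges : ∀ {n} → OGraph n → ℕ
edges G = countPairs (arc G)

VSet : ℕ → Set
VSet n = Fin n → Bool

_∈ₛ_ : ∀ {n} → Fin n → VSet n → Set
i ∈ₛ S = S i ≡ true

addB : Bool → ℕ → ℕ
addB true  m = suc m
addB false m = m

card : ∀ {n} → VSet n → ℕ
card {zero}  S = 0
card {suc n} S = addB (S zero) (card (S ∘ suc))

enumAux : ∀ {m n} (b : Bool) → (Fin m → Fin n) → Fin (addB b m) → Fin (suc n)
enumAux true  e zero    = zero
enumAux true  e (suc k) = suc (e k)
enumAux false e k       = suc (e k)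

enum : ∀ {n} (S : VSet n) → Fin (card S) → Fin n
enum {zero}  S ()
enum {suc n} S = enumAux (S zero) (enum (S ∘ suc))

-- G[S], the subgraph induced by S (with vertices relabelled by enum S)
induced : ∀ {n} → OGraph n → (S : VSet n) → OGraph (card S)
induced G S = record
  { arc      = λ i j → arc G (enum S i) (enum S j)
  ; irrefl   = λ i → irrefl G (enum S i)
  ; oriented = λ i j → oriented G (enum S i) (enum S j)
  }

record Iso {n m : ℕ} (G : OGraph n) (H : OGraph m) : Set where
  field
    bij      : Bijection (setoid (Fin n)) (setoid (Fin m))
    preserve : ∀ i j → arc H (Bijection.to bij i) (Bijection.to bij j) ≡ arc G i j

record SubgraphOf {m n : ℕ} (H : OGraph m) (G : OGraph n) : Set where
  field
    f      : Fin m → Fin n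
    inj    : Injective _≡_ _≡_ f
    arcMap : ∀ i j → arc H i j ≡ true → arc G (f i) (f j) ≡ true

record GraphProperty : Set₁ where
  field
    Holds    : ∀ {n} → OGraph n → Set
    isoClosed : ∀ {n m} {G : OGraph n} {H : OGraph m} → Iso G H → Holds G → Holds H
open GraphProperty public

Hereditary : GraphProperty → Set
Hereditary Π = ∀ {n} (G : OGraph n) (S : VSet n) → Holds Π G → Holds Π (induced G S)

data Reach {n} (G : OGraph n) (S : VSet n) : Fin n → Fin n → Set where
  here : ∀ {u} → u ∈ₛ S → Reach G S u u
  step : ∀ {u w v} → Reach G S u w → adj G w v ≡ true → v ∈ₛ S → Reach G S u v

-- G[S] is connected (the empty set counts as connected)
Connected : ∀ {n} → OGraph n → VSet n → Set
Connected G S = ∀ u v → u ∈ₛ S → v ∈ₛ S → Reach G S u v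

remove : ∀ {n} → VSet n → Fin n → VSet n
remove S v i = S i ∧ not ⌊ i ≟ v ⌋

Nonseparable : ∀ {n} → OGraph n → VSet n → Set
Nonseparable G S =
  (∃ λ v → v ∈ₛ S) × Connected G S × (∀ v → v ∈ₛ S → Connected G (remove S v))

_⊆ₛ_ : ∀ {n} → VSet n → VSet n → Set
S ⊆ₛ T = ∀ i → i ∈ₛ S → i ∈ₛ T

-- S spans a block of G: a maximal nonseparable vertex set
-- (blocks are induced subgraphs, namely G[S])
IsBlock : ∀ {n} → OGraph n → VSet n → Set
IsBlock G S = Nonseparable G S × (∀ T → S ⊆ₛ T → Nonseparable G T → T ⊆ₛ S)

same : Bool → Bool → Bool
same true  true  = true
same false false = true
same _     _     = false

crossing : ∀ {n} → OGraph n → VSet n → Fin n → Fin n → Bool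
crossing G p i j = arc G i j ∧ not (same (p i) (p j))

keptCrossing : ∀ {n} → OGraph n → VSet n → (Fin n → Fin n → Bool) → Fin n → Fin n → Bool
keptCrossing G p F i j = crossing G p i j ∧ F i j

private
  ∧-false : ∀ {a} b → a ≡ false → a ∧ b ≡ false
  ∧-false b refl = refl

keepOnly : ∀ {n} → OGraph n → VSet n → (Fin n → Fin n → Bool) → OGraph n
keepOnly G p F = record
  { arc      = λ i j → arc G i j ∧ (same (p i) (p j) ∨ F i j)
  ; irrefl   = λ i → ∧-false _ (irrefl G i)
  ; oriented = λ i j a → ∧-false _ (oriented G i j (lemma (arc G i j) a))
  }
  where
  lemma : ∀ x {y} → x ∧ y ≡ true → x ≡ true
  lemma true _ = refl

ℕtoℚ : ℕ → ℚ
ℕtoℚ k = + k / 1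

record StronglyExtendible (λ′ : ℚ) (Π : GraphProperty) : Set where
  field
    inclK1 : (G : OGraph 1) → Holds Π G
    inclK2 : (G : OGraph 2) → adj G zero (suc zero) ≡ true → Holds Π G
    blockAdd : ∀ {n} (G : OGraph n) →
      (Holds Π G → ∀ S → IsBlock G S → Holds Π (induced G S)) ×
      ((∀ S → IsBlock G S → Holds Π (induced G S)) → Holds Π G)
    -- strong λ-subgraph extension; U = p⁻¹ true, W = p⁻¹ false
    extension : ∀ {n} (G : OGraph n) (p : VSet n) →
      Holds Π (induced G p) → Holds Π (induced G (not ∘ p)) →
      Σ (Fin n → Fin n → Bool) λ F →
        ((λ′ *ℚ ℕtoℚ (countPairs (crossing G p))) ≤ℚ ℕtoℚ (countPairs (keptCrossing G p F)))
        × Holds Π (keepOnly G p F)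

cycArc : Fin 3 → Fin 3 → Bool
cycArc zero (suc zero) = true
cycArc (suc zero) (suc (suc zero)) = true
cycArc (suc (suc zero)) zero = true
cycArc _ _ = false

trArc : Fin 3 → Fin 3 → Bool
trArc zero (suc zero) = true
trArc (suc zero) (suc (suc zero)) = true
trArc zero (suc (suc zero)) = true
trArc _ _ = false

orientedK3 : OGraph 3
orientedK3 = record { arc = cycArc ; irrefl = ir ; oriented = or }
  where
  ir : ∀ i → cycArc i i ≡ false
  ir zero = refl
  ir (suc zero) = refl
  ir (suc (suc zero)) = refl
  or : ∀ i j → cycArc i j ≡ true → cycArc j i ≡ false
  or zero (suc zero) _ = refl
  or (suc zero) (suc (suc zero)) _ = refl
  or (suc (suc zero)) zero _ = refl
  or zero zero ()
  or zero (suc (suc zero)) ()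
  or (suc zero) zero ()
  or (suc zero) (suc zero) ()
  or (suc (suc zero)) (suc zero) ()
  or (suc (suc zero)) (suc (suc zero)) ()

transitiveK3 : OGraph 3
transitiveK3 = record { arc = trArc ; irrefl = ir ; oriented = or }
  where
  ir : ∀ i → trArc i i ≡ false
  ir zero = refl
  ir (suc zero) = refl
  ir (suc (suc zero)) = refl
  or : ∀ i j → trArc i j ≡ true → trArc j i ≡ false
  or zero (suc zero) _ = refl
  or (suc zero) (suc (suc zero)) _ = refl
  or zero (suc (suc zero)) _ = refl
  or zero zero ()
  or (suc zero) zero ()
  or (suc zero) (suc zero) ()
  or (suc (suc zero)) zero ()
  or (suc (suc zero)) (suc zero) ()
  or (suc (suc zero)) (suc (suc zero)) ()

-- U(G) = K_j
IsTournament : ∀ {j} → OGraph j → Set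
IsTournament G = ∀ u v → u ≢ v → adj G u v ≡ true

IsBeta : GraphProperty → ∀ {n} → OGraph n → ℕ → Set
IsBeta Π G b =
  (Σ ℕ λ m → Σ (OGraph m) λ H → SubgraphOf H G × Holds Π H × edges H ≡ b) ×
  (∀ {m} (H : OGraph m) → SubgraphOf H G → Holds Π H → edges H ≤ b)

IsBetaK : GraphProperty → ℕ → ℕ → Set
IsBetaK Π j b =
  (Σ (OGraph j) λ T → IsTournament T × IsBeta Π T b) ×
  (∀ (T : OGraph j) → IsTournament T → ∀ b′ → IsBeta Π T b′ → b ≤ b′)

ex : ℚ → ℕ → ℕ → ℚ
ex λ′ j b = ℕtoℚ b -ℚ ((λ′ *ℚ ℕtoℚ (j C 2)) +ℚ (((1ℚ -ℚ λ′) *ℚ (+ 1 / 2)) *ℚ ℕtoℚ (j ∸ 1)))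

module Submission where

-- As ex(K_j) = β(K_j) − (j² − 1)/4, it suffices that j² ≤ 4b whenever every Π-subgraph of a
-- tournament T on j vertices has at most b edges.  Such subgraphs are grown greedily inside T:
-- to a Π-subgraph H supported on a vertex set A and a vertex v ∉ A we add all arcs of T between
-- v and A, and the extension property for the cut ({v}, rest) keeps at least half of these |A|
-- arcs.  Starting from nothing this gives 4|E(H)| + 1 ≥ j², enough for even j.  For odd j ≥ 5
-- the run starts from a transitive triangle {0, x, y} (0 sends or receives both arcs; x and y
-- exist by pigeonhole), one edge above ⌊9/4⌋; the surplus edge survives and gives j² ≤ 4|E(H)|.

open import Defs
import Data.Nat.Properties as ℕP
open import Algebra.Properties.CommutativeSemigroup ℕP.+-commutativeSemigroup using (interchange)
open import Data.Bool using (Bool; true; false; _∧_; _∨_; not; if_then_else_)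
open import Data.Bool.Properties using (¬-not; not-injective; ∧-identityʳ; ∧-zeroʳ; ∨-identityʳ; ∨-zeroʳ)
import Data.Bool.Properties as 𝔹
open import Data.Empty using (⊥-elim)
open import Data.Fin using (Fin; zero; suc; _≟_; #_; inject≤)
open import Data.Fin.Permutation using (Permutation′; _⟨$⟩ʳ_; id; transpose; _∘ₚ_)
open import Data.Fin.Properties using (all?; ¬∀⟶∃¬; suc-injective; inject≤-injective)
open import Data.Nat using (ℕ; zero; suc; _+_; _*_; _∸_; _≤_; _<_; z≤n; s≤s)
open import Data.Nat.Combinatorics using (_C_; nCk+nC[k+1]≡[n+1]C[k+1]; nC1≡n)
open import Data.Nat.Tactic.RingSolver using (solve-∀)
open import Data.Product using (Σ; ∃; _×_; _,_; proj₁; proj₂)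
open import Data.Rational using (½; 0ℚ) renaming (_<_ to _<ℚ_)
open import Data.Sum using (_⊎_; inj₁; inj₂)
open import Function using (_∘_; case_of_)
open import Function.Construct.Identity using (⤖-id)
open import Function.Properties.Inverse using (↔⇒⤖)
open import Relation.Binary.PropositionalEquality
open import Relation.Nullary using (¬_; yes; no)
open import Relation.Nullary.Decidable using (⌊_⌋; toSum)

∧-elimˡ : ∀ {a b} → a ∧ b ≡ true → a ≡ true
∧-elimˡ {true} _ = refl

∧-elimʳ : ∀ {a b} → a ∧ b ≡ true → b ≡ true
∧-elimʳ {true} e = e

not-true : ∀ {a} → not a ≡ true → a ≡ false
not-true {false} _ = refl

pigeonhole : (f : Fin 3 → Bool) → ∃ λ a → ∃ λ b → a ≢ b × f a ≡ f b
pigeonhole f with f (# 0) 𝔹.≟ f (# 1) | f (# 0) 𝔹.≟ f (# 2)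
... | yes e   | _       = # 0 , # 1 , (λ ()) , e
... | no _    | yes e   = # 0 , # 2 , (λ ()) , e
... | no d₀₁  | no d₀₂  = # 1 , # 2 , (λ ()) , not-injective (trans (sym (¬-not d₀₁)) (¬-not d₀₂))

b2n-∨ : ∀ {a b} → (a ≡ true → b ≡ false) → b2n (a ∨ b) ≡ b2n a + b2n b
b2n-∨ {true}  disjoint rewrite disjoint refl = refl
b2n-∨ {false} _ = refl

sumFin-cong : ∀ {n} {f g : Fin n → ℕ} → (∀ i → f i ≡ g i) → sumFin f ≡ sumFin g
sumFin-cong {zero}  _ = refl
sumFin-cong {suc n} h = cong₂ _+_ (h zero) (sumFin-cong (h ∘ suc))

sumFin-+ : ∀ {n} (f g : Fin n → ℕ) → sumFin (λ i → f i + g i) ≡ sumFin f + sumFin g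
sumFin-+ {zero}  f g = refl
sumFin-+ {suc n} f g = trans (cong (f zero + g zero +_) (sumFin-+ (f ∘ suc) (g ∘ suc)))
                             (interchange (f zero) (g zero) _ _)

sumFin-zero : ∀ n → sumFin {n} (λ _ → 0) ≡ 0
sumFin-zero zero    = refl
sumFin-zero (suc n) = sumFin-zero n

sumFin-if : ∀ {n} b (f : Fin n → ℕ) → sumFin (λ i → if b then f i else 0) ≡ (if b then sumFin f else 0)
sumFin-if {n} true  f = refl
sumFin-if {n} false f = sumFin-zero n

-- the equality test commutes with suc (only propositionally, so it has to be stated)
≟-suc : ∀ {n} (i v : Fin n) → ⌊ suc i ≟ suc v ⌋ ≡ ⌊ i ≟ v ⌋
≟-suc i v with i ≟ v
... | yes _ = refl
... | no _  = refl

sumFin-delta : ∀ {n} (v : Fin n) (f : Fin n → ℕ) → sumFin (λ i → if ⌊ i ≟ v ⌋ then f i else 0) ≡ f v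
sumFin-delta {suc n} zero    f = trans (cong (f zero +_) (sumFin-zero n)) (ℕP.+-identityʳ (f zero))
sumFin-delta {suc n} (suc v) f =
  trans (sumFin-cong (λ i → cong (λ b → if b then f (suc i) else 0) (≟-suc i v))) (sumFin-delta v (f ∘ suc))

countPairs-cong : ∀ {n} {P Q : Fin n → Fin n → Bool} → (∀ i j → P i j ≡ Q i j) → countPairs P ≡ countPairs Q
countPairs-cong h = sumFin-cong (λ i → sumFin-cong (λ j → cong b2n (h i j)))

countPairs-split : ∀ {n} (P Q R : Fin n → Fin n → Bool) → (∀ i j → b2n (P i j) ≡ b2n (Q i j) + b2n (R i j)) →
  countPairs P ≡ countPairs Q + countPairs R
countPairs-split P Q R h =
  trans (sumFin-cong (λ i → trans (sumFin-cong (h i)) (sumFin-+ (λ j → b2n (Q i j)) (λ j → b2n (R i j)))))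
        (sumFin-+ (λ i → sumFin (λ j → b2n (Q i j))) (λ i → sumFin (λ j → b2n (R i j))))

∅ : ∀ {n} → VSet n
∅ _ = false

single : ∀ {n} → Fin n → VSet n
single v i = ⌊ i ≟ v ⌋

insert : ∀ {n} → Fin n → VSet n → VSet n
insert v A i = A i ∨ single v i

single-self : ∀ {n} (v : Fin n) → single v v ≡ true
single-self v with v ≟ v
... | yes _   = refl
... | no v≢v = ⊥-elim (v≢v refl)

single-other : ∀ {n} {v i : Fin n} → i ≢ v → single v i ≡ false
single-other {v = v} {i} i≢v with i ≟ v
... | yes i≡v = ⊥-elim (i≢v i≡v)
... | no _    = refl

single-true : ∀ {n} {v i : Fin n} → single v i ≡ true → i ≡ v
single-true {v = v} {i} i∈v with i ≟ v
single-true _  | yes i≡v = i≡v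
single-true () | no _

outside-single : ∀ {n} {v i : Fin n} → not (single v i) ≡ true → i ≢ v
outside-single {v = v} i∉v refl = case subst (λ b → not b ≡ true) (single-self v) i∉v of λ ()

insert-new : ∀ {n} (v : Fin n) (A : VSet n) → insert v A v ≡ true
insert-new v A = trans (cong (A v ∨_) (single-self v)) (∨-zeroʳ (A v))

insert-old : ∀ {n} {v u : Fin n} (A : VSet n) → A u ≡ true → insert v A u ≡ true
insert-old A u∈A rewrite u∈A = refl

insert-∉ : ∀ {n} {v u : Fin n} {A : VSet n} → A u ≡ false → u ≢ v → insert v A u ≡ false
insert-∉ u∉A u≢v rewrite u∉A = single-other u≢v

insert-member : ∀ {n} {v u : Fin n} (A : VSet n) → insert v A u ≡ true → A u ≡ true ⊎ u ≡ v
insert-member {u = u} A u∈ with A u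
... | true  = inj₁ refl
... | false = inj₂ (single-true u∈)

insert-other : ∀ {n} {v u : Fin n} (A : VSet n) → insert v A u ≡ true → u ≢ v → A u ≡ true
insert-other A u∈ u≢v with insert-member A u∈
... | inj₁ u∈A = u∈A
... | inj₂ u≡v = ⊥-elim (u≢v u≡v)

outside-vertex : ∀ {n} (A : VSet n) → (∃ λ v → A v ≡ false) ⊎ (∀ v → A v ≡ true)
outside-vertex {n} A with all? (λ v → A v 𝔹.≟ true)
... | yes all∈A = inj₂ all∈A
... | no ¬all   with ¬∀⟶∃¬ n (λ v → A v ≡ true) (λ v → A v 𝔹.≟ true) ¬all
...   | v , v∉A = inj₁ (v , ¬-not v∉A)

card-sum : ∀ {n} (S : VSet n) → card S ≡ sumFin (b2n ∘ S)
card-sum {zero}  S = refl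
card-sum {suc n} S = trans (addB-b2n (S zero)) (cong (b2n (S zero) +_) (card-sum (S ∘ suc)))
  where
  addB-b2n : ∀ b {m} → addB b m ≡ b2n b + m
  addB-b2n true  = refl
  addB-b2n false = refl

-- basic cardinalities; |S| ≤ n bounds the number of greedy steps
card-≤ : ∀ {n} (S : VSet n) → card S ≤ n
card-≤ {zero}  S = z≤n
card-≤ {suc n} S with S zero
... | true  = s≤s (card-≤ (S ∘ suc))
... | false = ℕP.m≤n⇒m≤1+n (card-≤ (S ∘ suc))

card-∅ : ∀ {n} → card {n} ∅ ≡ 0
card-∅ {zero}  = refl
card-∅ {suc n} = card-∅ {n}

card-full : ∀ {n} {S : VSet n} → (∀ i → S i ≡ true) → card S ≡ n
card-full {zero}  _ = refl
card-full {suc n} {S} full rewrite full zero = cong suc (card-full (full ∘ suc))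

card-one : ∀ {n} (S : VSet n) (w : Fin n) → S w ≡ true → (∀ u → S u ≡ true → u ≡ w) → card S ≡ 1
card-one S w w∈S only = trans (card-sum S) (trans (sumFin-cong indicator) (sumFin-delta w (λ _ → 1)))
  where
  indicator : ∀ u → b2n (S u) ≡ (if ⌊ u ≟ w ⌋ then 1 else 0)
  indicator u with u ≟ w
  ... | yes refl = cong b2n w∈S
  ... | no u≢w with S u in u∈S
  ...   | true  = ⊥-elim (u≢w (only u u∈S))
  ...   | false = refl

card-insert : ∀ {n} {v : Fin n} {A : VSet n} → A v ≡ false → card (insert v A) ≡ suc (card A)
card-insert {v = v} {A} v∉A = begin
  card (insert v A)                                          ≡⟨ card-sum (insert v A) ⟩
  sumFin (λ i → b2n (insert v A i))                          ≡⟨ sumFin-cong split ⟩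
  sumFin (λ i → b2n (A i) + (if ⌊ i ≟ v ⌋ then 1 else 0))    ≡⟨ sumFin-+ (b2n ∘ A) _ ⟩
  sumFin (b2n ∘ A) + sumFin (λ i → if ⌊ i ≟ v ⌋ then 1 else 0) ≡⟨ cong₂ _+_ (sym (card-sum A)) (sumFin-delta v (λ _ → 1)) ⟩
  card A + 1                                                 ≡⟨ ℕP.+-comm (card A) 1 ⟩
  suc (card A)                                               ∎
  where
  open ≡-Reasoning
  split : ∀ i → b2n (insert v A i) ≡ b2n (A i) + (if ⌊ i ≟ v ⌋ then 1 else 0)
  split i with i ≟ v
  ... | yes refl rewrite v∉A = refl
  ... | no _ = trans (cong b2n (∨-identityʳ (A i))) (sym (ℕP.+-identityʳ (b2n (A i))))

enum-in : ∀ {n} (S : VSet n) (k : Fin (card S)) → S (enum S k) ≡ true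
enum-in {suc n} S k with S zero in 0∈S
enum-in {suc n} S zero    | true  = 0∈S
enum-in {suc n} S (suc k) | true  = enum-in (S ∘ suc) k
enum-in {suc n} S k       | false = enum-in (S ∘ suc) k

enum-injective : ∀ {n} (S : VSet n) {k l : Fin (card S)} → enum S k ≡ enum S l → k ≡ l
enum-injective {suc n} S {k} {l} eq with S zero
enum-injective {suc n} S {zero}  {zero}  eq | true = refl
enum-injective {suc n} S {suc k} {suc l} eq | true = cong suc (enum-injective (S ∘ suc) (suc-injective eq))
enum-injective {suc n} S {k}     {l}     eq | false = enum-injective (S ∘ suc) (suc-injective eq)

internal : ∀ {n} → OGraph n → VSet n → Fin n → Fin n → Bool
internal G p i j = arc G i j ∧ same (p i) (p j)

edges-split : ∀ {n} (G : OGraph n) (p : VSet n) →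
  edges G ≡ countPairs (internal G p) + countPairs (crossing G p)
edges-split G p = countPairs-split _ _ _ (λ i j → split (arc G i j) (same (p i) (p j)))
  where
  split : ∀ a s → b2n a ≡ b2n (a ∧ s) + b2n (a ∧ not s)
  split true  true  = refl
  split true  false = refl
  split false _     = refl

edges-keepOnly : ∀ {n} (G : OGraph n) (p : VSet n) (F : Fin n → Fin n → Bool) →
  edges (keepOnly G p F) ≡ countPairs (internal G p) + countPairs (keptCrossing G p F)
edges-keepOnly G p F = countPairs-split _ _ _ (λ i j → split (arc G i j) (same (p i) (p j)) (F i j))
  where
  split : ∀ a s f → b2n (a ∧ (s ∨ f)) ≡ b2n (a ∧ s) + b2n ((a ∧ not s) ∧ f)
  split true  true  _ = refl
  split true  false _ = refl
  split false _     _ = refl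

degree : ∀ {n} → OGraph n → Fin n → ℕ
degree G v = sumFin (λ u → b2n (adj G v u))

crossing-single : ∀ {n} (G : OGraph n) (v : Fin n) → countPairs (crossing G (single v)) ≡ degree G v
crossing-single {n} G v = begin
  countPairs (crossing G (single v))
    ≡⟨ sumFin-cong (λ i → trans (sumFin-cong (at-v i)) (sumFin-+ (from i) (into i))) ⟩
  sumFin (λ i → sumFin (from i) + sumFin (into i))
    ≡⟨ sumFin-cong (λ i → cong₂ _+_ (sumFin-if ⌊ i ≟ v ⌋ (row i)) (sumFin-delta v (row i))) ⟩
  sumFin (λ i → (if ⌊ i ≟ v ⌋ then sumFin (row i) else 0) + row i v)
    ≡⟨ sumFin-+ (λ i → if ⌊ i ≟ v ⌋ then sumFin (row i) else 0) (λ i → row i v) ⟩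
  sumFin (λ i → if ⌊ i ≟ v ⌋ then sumFin (row i) else 0) + sumFin (λ i → row i v)
    ≡⟨ cong (_+ sumFin (λ i → row i v)) (sumFin-delta v (λ i → sumFin (row i))) ⟩
  sumFin (row v) + sumFin (λ u → row u v)
    ≡⟨ sumFin-+ (row v) (λ u → row u v) ⟨
  sumFin (λ u → row v u + row u v)
    ≡⟨ sumFin-cong (λ u → b2n-∨ (oriented G v u)) ⟨
  degree G v ∎
  where
  open ≡-Reasoning
  row : Fin n → Fin n → ℕ
  row i j = b2n (arc G i j)
  from into : Fin n → Fin n → ℕ
  from i j = if ⌊ i ≟ v ⌋ then row i j else 0
  into i j = if ⌊ j ≟ v ⌋ then row i j else 0
  -- a crossing arc starts at v or ends at v, but not both
  at-v : ∀ i j → b2n (arc G i j ∧ not (same ⌊ i ≟ v ⌋ ⌊ j ≟ v ⌋)) ≡ from i j + into i j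
  at-v i j with i ≟ v | j ≟ v
  ... | yes refl | yes refl rewrite irrefl G v = refl
  ... | yes refl | no _     = trans (cong b2n (∧-identityʳ _)) (sym (ℕP.+-identityʳ _))
  ... | no _     | yes refl = cong b2n (∧-identityʳ _)
  ... | no _     | no _     = cong b2n (∧-zeroʳ _)

data EvenOdd : ℕ → Set where
  even : ∀ m → EvenOdd (m + m)
  odd  : ∀ m → EvenOdd (suc (m + m))

even-or-odd : ∀ n → EvenOdd n
even-or-odd zero = even 0
even-or-odd (suc n) with even-or-odd n
... | even m = odd m
... | odd m  = subst EvenOdd (cong suc (ℕP.+-suc m m)) (even (suc m))

quarter : ∀ c a → 4 * c ≤ 4 * a + 1 → c ≤ a
quarter c a h = ℕP.≤-pred (ℕP.*-cancelˡ-< 4 c (suc a)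
  (ℕP.≤-trans (s≤s h) (ℕP.≤-trans (ℕP.m≤m+n _ 2) (ℕP.≤-reflexive (spread a)))))
  where
  spread : ∀ a → suc (4 * a + 1) + 2 ≡ 4 * suc a
  spread = solve-∀

twice : ∀ m → m + m ≡ 2 * m
twice = solve-∀

-- One greedy step: adding a vertex adjacent to k chosen vertices and keeping at least
-- half of the k new arcs preserves  k² + 4δ ≤ 4e + 1.
greedy-arith : ∀ k e x δ → k * k + 4 * δ ≤ 4 * e + 1 → k ≤ 2 * x → suc k * suc k + 4 * δ ≤ 4 * (e + x) + 1
greedy-arith k e x δ h k≤2x with even-or-odd k
... | even m = begin
  suc (m + m) * suc (m + m) + 4 * δ ≡⟨ square-even m δ ⟩
  4 * (m * m + δ + m) + 1           ≤⟨ ℕP.+-monoˡ-≤ 1 (ℕP.*-monoʳ-≤ 4 (ℕP.+-mono-≤ mm+δ≤e m≤x)) ⟩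
  4 * (e + x) + 1                   ∎
  where
  open ℕP.≤-Reasoning
  square-even : ∀ m δ → suc (m + m) * suc (m + m) + 4 * δ ≡ 4 * (m * m + δ + m) + 1
  square-even = solve-∀
  mm+δ≤e : m * m + δ ≤ e
  mm+δ≤e = quarter (m * m + δ) e (ℕP.≤-trans (ℕP.≤-reflexive (double-square m δ)) h)
    where
    double-square : ∀ m δ → 4 * (m * m + δ) ≡ (m + m) * (m + m) + 4 * δ
    double-square = solve-∀
  m≤x : m ≤ x
  m≤x = ℕP.*-cancelˡ-≤ 2 (ℕP.≤-trans (ℕP.≤-reflexive (sym (twice m))) k≤2x)
... | odd m = begin
  suc (suc (m + m)) * suc (suc (m + m)) + 4 * δ ≡⟨ square-odd m δ ⟩
  4 * (m * m + m + δ + suc m)                   ≤⟨ ℕP.*-monoʳ-≤ 4 (ℕP.+-mono-≤ mm+m+δ≤e m<x) ⟩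
  4 * (e + x)                                   ≤⟨ ℕP.m≤m+n (4 * (e + x)) 1 ⟩
  4 * (e + x) + 1                               ∎
  where
  open ℕP.≤-Reasoning
  square-odd : ∀ m δ → suc (suc (m + m)) * suc (suc (m + m)) + 4 * δ ≡ 4 * (m * m + m + δ + suc m)
  square-odd = solve-∀
  mm+m+δ≤e : m * m + m + δ ≤ e
  mm+m+δ≤e = quarter (m * m + m + δ) e
    (ℕP.≤-trans (ℕP.m≤m+n _ 1) (ℕP.≤-trans (ℕP.≤-reflexive (square m δ)) h))
    where
    square : ∀ m δ → 4 * (m * m + m + δ) + 1 ≡ suc (m + m) * suc (m + m) + 4 * δ
    square = solve-∀
  m<x : suc m ≤ x
  m<x = ℕP.*-cancelˡ-< 2 m x (ℕP.≤-trans (ℕP.≤-reflexive (cong suc (sym (twice m)))) k≤2x)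

-- an even square is divisible by 4, so the +1 slack can be dropped
even-square : ∀ m e → (m + m) * (m + m) + 4 * 0 ≤ 4 * e + 1 → (m + m) * (m + m) ≤ 4 * e
even-square m e h = begin
  (m + m) * (m + m) ≡⟨ square m ⟨
  4 * (m * m)       ≤⟨ ℕP.*-monoʳ-≤ 4 (quarter (m * m) e (ℕP.≤-trans (ℕP.≤-reflexive (square′ m)) h)) ⟩
  4 * e             ∎
  where
  open ℕP.≤-Reasoning
  square : ∀ m → 4 * (m * m) ≡ (m + m) * (m + m)
  square = solve-∀
  square′ : ∀ m → 4 * (m * m) ≡ (m + m) * (m + m) + 4 * 0
  square′ = solve-∀

-- a surplus of one edge absorbs the +1 slack
surplus-square : ∀ j e → j * j + 4 * 1 ≤ 4 * e + 1 → j * j ≤ 4 * e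
surplus-square j e h =
  ℕP.m+n≤o⇒m≤o (j * j) (ℕP.+-cancelʳ-≤ 1 (j * j + 3) (4 * e) (ℕP.≤-trans (ℕP.≤-reflexive (shift j)) h))
  where
  shift : ∀ j → j * j + 3 + 1 ≡ j * j + 4 * 1
  shift = solve-∀

double-choose-2 : ∀ m → 2 * (suc m C 2) ≡ suc m * m
double-choose-2 zero    = refl
double-choose-2 (suc m) = begin
  2 * (suc (suc m) C 2)       ≡⟨ cong (2 *_) (nCk+nC[k+1]≡[n+1]C[k+1] (suc m) 1) ⟨
  2 * (suc m C 1 + suc m C 2) ≡⟨ cong (λ c → 2 * (c + suc m C 2)) (nC1≡n (suc m)) ⟩
  2 * (suc m + suc m C 2)     ≡⟨ ℕP.*-distribˡ-+ 2 (suc m) _ ⟩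
  2 * suc m + 2 * (suc m C 2) ≡⟨ cong (2 * suc m +_) (double-choose-2 m) ⟩
  2 * suc m + suc m * m       ≡⟨ expand m ⟩
  suc (suc m) * suc m         ∎
  where
  open ≡-Reasoning
  expand : ∀ m → 2 * suc m + suc m * m ≡ suc (suc m) * suc m
  expand = solve-∀

-- 4·(½·C(j,2) + ¼·(j − 1)) = j² − 1
pairs-bound : ∀ j b → 1 ≤ j → j * j ≤ 4 * b → 2 * (j C 2) + (j ∸ 1) < 4 * b
pairs-bound (suc m) b _ h =
  ℕP.≤-trans (ℕP.≤-reflexive (trans (cong (λ c → suc (c + m)) (double-choose-2 m)) (square m))) h
  where
  square : ∀ m → suc (suc m * m + m) ≡ suc m * suc m
  square = solve-∀

-- The embedding ℕtoℚ is an order embedding and a semiring homomorphism; this translates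
-- the rational inequalities of the extension property and of ex(K_j) into ℕ.
module Embedding where
  open import Data.Integer as ℤ using (+_; +<+)
  import Data.Integer.Properties as ℤP
  open import Data.Nat.Coprimality using (1-coprimeTo) renaming (sym to coprime-sym)
  open import Data.Rational using (ℚ; mkℚ; ½; 0ℚ; 1ℚ; *<*; -_)
    renaming (_+_ to _+ℚ_; _*_ to _*ℚ_; _-_ to _-ℚ_; _≤_ to _≤ℚ_; _<_ to _<ℚ_; _/_ to _/ℚ_)
  import Data.Rational.Properties as ℚP
  open import Data.Rational.Solver using (module +-*-Solver)

  ℕtoℚ-mkℚ : ∀ n → ℕtoℚ n ≡ mkℚ (+ n) 0 (coprime-sym (1-coprimeTo n))
  ℕtoℚ-mkℚ n = ℚP.normalize-coprime (coprime-sym (1-coprimeTo n))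

  ℕtoℚ-* : ∀ m n → ℕtoℚ (m * n) ≡ ℕtoℚ m *ℚ ℕtoℚ n
  ℕtoℚ-* m n rewrite ℕtoℚ-mkℚ m | ℕtoℚ-mkℚ n =
    sym (ℚP./-cong {p₁ = + m ℤ.* + n} {q₁ = 1} {p₂ = + (m * n)} {q₂ = 1} (sym (ℤP.pos-* m n)) refl)

  ℕtoℚ-+ : ∀ m n → ℕtoℚ (m + n) ≡ ℕtoℚ m +ℚ ℕtoℚ n
  ℕtoℚ-+ m n rewrite ℕtoℚ-mkℚ m | ℕtoℚ-mkℚ n =
    sym (ℚP./-cong {p₁ = + m ℤ.* + 1 ℤ.+ + n ℤ.* + 1} {q₁ = 1} {p₂ = + (m + n)} {q₂ = 1}
      (trans (cong₂ ℤ._+_ (ℤP.*-identityʳ (+ m)) (ℤP.*-identityʳ (+ n))) (sym (ℤP.pos-+ m n))) refl)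

  ℕtoℚ-mono-< : ∀ {m n} → m < n → ℕtoℚ m <ℚ ℕtoℚ n
  ℕtoℚ-mono-< {m} {n} m<n rewrite ℕtoℚ-mkℚ m | ℕtoℚ-mkℚ n =
    *<* (subst₂ ℤ._<_ (sym (ℤP.*-identityʳ (+ m))) (sym (ℤP.*-identityʳ (+ n))) (+<+ m<n))

  ℕtoℚ-cancel-≤ : ∀ {m n} → ℕtoℚ m ≤ℚ ℕtoℚ n → m ≤ n
  ℕtoℚ-cancel-≤ m≤n = ℕP.≮⇒≥ (λ n<m → ℚP.<-irrefl refl (ℚP.<-≤-trans (ℕtoℚ-mono-< n<m) m≤n))

  half : ∀ {c x} → ½ *ℚ ℕtoℚ c ≤ℚ ℕtoℚ x → c ≤ 2 * x
  half {c} {x} h = ℕtoℚ-cancel-≤ (subst₂ _≤ℚ_ cancel (sym (ℕtoℚ-* 2 x)) (ℚP.*-monoˡ-≤-nonNeg (ℕtoℚ 2) h))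
    where
    cancel : ℕtoℚ 2 *ℚ (½ *ℚ ℕtoℚ c) ≡ ℕtoℚ c
    cancel = trans (sym (ℚP.*-assoc (ℕtoℚ 2) ½ (ℕtoℚ c))) (ℚP.*-identityˡ (ℕtoℚ c))

  positive-excess : ∀ j b → 2 * (j C 2) + (j ∸ 1) < 4 * b → 0ℚ <ℚ ex ½ j b
  positive-excess j b lt = subst₂ _<ℚ_ (ℚP.+-inverseʳ q) refl (ℚP.+-monoˡ-< (- q) q<b)
    where
    c = ℕtoℚ (j C 2)
    d = ℕtoℚ (j ∸ 1)
    q = ½ *ℚ c +ℚ ((1ℚ -ℚ ½) *ℚ (+ 1 /ℚ 2)) *ℚ d
    four-q : ℕtoℚ 4 *ℚ q ≡ ℕtoℚ (2 * (j C 2) + (j ∸ 1))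
    four-q = trans (expand c d) (sym (trans (ℕtoℚ-+ (2 * (j C 2)) (j ∸ 1)) (cong (_+ℚ d) (ℕtoℚ-* 2 (j C 2)))))
      where
      open +-*-Solver
      expand : ∀ c d → ℕtoℚ 4 *ℚ (½ *ℚ c +ℚ ((1ℚ -ℚ ½) *ℚ (+ 1 /ℚ 2)) *ℚ d) ≡ ℕtoℚ 2 *ℚ c +ℚ d
      expand = solve 2 (λ c d → con (ℕtoℚ 4) :* (con ½ :* c :+ con ((1ℚ -ℚ ½) *ℚ (+ 1 /ℚ 2)) :* d)
                                := con (ℕtoℚ 2) :* c :+ d) refl
    q<b : q <ℚ ℕtoℚ b
    q<b = ℚP.*-cancelˡ-<-nonNeg (ℕtoℚ 4) (subst₂ _<ℚ_ (sym four-q) (ℕtoℚ-* 4 b) (ℕtoℚ-mono-< lt))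

module Extendible (Π : GraphProperty) (SE : StronglyExtendible ½ Π) where
  open StronglyExtendible SE

  holds-cong : ∀ {n} {G H : OGraph n} → (∀ i j → arc H i j ≡ arc G i j) → Holds Π G → Holds Π H
  holds-cong {n} same-arcs = isoClosed Π (record { bij = ⤖-id (Fin n) ; preserve = same-arcs })

  holds-induced-cong : ∀ {n} (G H : OGraph n) (S : VSet n) →
    (∀ a b → S a ≡ true → S b ≡ true → arc H a b ≡ arc G a b) → Holds Π (induced G S) → Holds Π (induced H S)
  holds-induced-cong G H S agree = holds-cong (λ k l → agree (enum S k) (enum S l) (enum-in S k) (enum-in S l))

  -- without arcs every block is a single vertex, which is in Π by inclusiveness
  edgeless : ∀ {n} (G : OGraph n) → (∀ i j → arc G i j ≡ false) → Holds Π G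
  edgeless G no-arc = proj₂ (blockAdd G) λ S block →
    let ((w , w∈S) , connected , _) = proj₁ block
    in one-vertex (induced G S) (card-one S w w∈S (λ u u∈S → stays (connected u w u∈S w∈S)))
    where
    one-vertex : ∀ {m} (H : OGraph m) → m ≡ 1 → Holds Π H
    one-vertex H refl = inclK1 H
    no-adj : ∀ w v → adj G w v ≡ true → ∀ {A : Set} → A
    no-adj w v a rewrite no-arc w v | no-arc v w = case a of λ ()
    stays : ∀ {S u v} → Reach G S u v → u ≡ v
    stays (here _)              = refl
    stays (step {w = w} {v} _ a _) = no-adj w v a

  edgeless-induced : ∀ {n} (G : OGraph n) (S : VSet n) →
    (∀ a b → S a ≡ true → S b ≡ true → arc G a b ≡ false) → Holds Π (induced G S)
  edgeless-induced G S no-arc = edgeless (induced G S) (λ k l → no-arc _ _ (enum-in S k) (enum-in S l))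

  -- if no arc crosses the partition, both sides in Π put G in Π (extension deletes nothing)
  disjoint-union : ∀ {n} (G : OGraph n) (S : VSet n) → (∀ i j → arc G i j ≡ true → same (S i) (S j) ≡ true) →
    Holds Π (induced G S) → Holds Π (induced G (not ∘ S)) → Holds Π G
  disjoint-union G S no-crossing inS outS = holds-cong unchanged (proj₂ (proj₂ extended))
    where
    extended = extension G S inS outS
    unchanged : ∀ i j → arc G i j ≡ arc G i j ∧ (same (S i) (S j) ∨ proj₁ extended i j)
    unchanged i j with arc G i j in a
    ... | true  rewrite no-crossing i j a = refl
    ... | false = refl

module Triangles (Π : GraphProperty) (tK3 : Holds Π transitiveK3) where

  transitive-triple : (G : OGraph 3) (σ : Permutation′ 3) →
    arc G (σ ⟨$⟩ʳ # 0) (σ ⟨$⟩ʳ # 1) ≡ true → arc G (σ ⟨$⟩ʳ # 1) (σ ⟨$⟩ʳ # 2) ≡ true →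
    arc G (σ ⟨$⟩ʳ # 0) (σ ⟨$⟩ʳ # 2) ≡ true → Holds Π G
  transitive-triple G σ a01 a12 a02 = isoClosed Π (record { bij = ↔⇒⤖ σ ; preserve = matches }) tK3
    where
    matches : ∀ i j → arc G (σ ⟨$⟩ʳ i) (σ ⟨$⟩ʳ j) ≡ trArc i j
    matches zero             zero             = irrefl G _
    matches zero             (suc zero)       = a01
    matches zero             (suc (suc zero)) = a02
    matches (suc zero)       zero             = oriented G _ _ a01
    matches (suc zero)       (suc zero)       = irrefl G _
    matches (suc zero)       (suc (suc zero)) = a12
    matches (suc (suc zero)) zero             = oriented G _ _ a02
    matches (suc (suc zero)) (suc zero)       = oriented G _ _ a12
    matches (suc (suc zero)) (suc (suc zero)) = irrefl G _

  reverse-arc : ∀ {n} (G : OGraph n) → IsTournament G → ∀ {i j} → i ≢ j → arc G i j ≡ false → arc G j i ≡ true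
  reverse-arc G tG {i} {j} i≢j no-ij = trans (cong (_∨ arc G j i) (sym no-ij)) (tG i j i≢j)

  -- a three-vertex tournament in which vertex 0 is a source or a sink is transitive
  -- (the vertex count is kept abstract, since it arises as the size of a vertex set)
  source-or-sink-triangle : ∀ {m} (G : OGraph (suc m)) → suc m ≡ 3 → IsTournament G →
    (∀ a b → a ≢ zero → b ≢ zero → arc G zero a ≡ arc G zero b) → Holds Π G
  source-or-sink-triangle G refl tG uniform = by-orientation (uniform (# 2) (# 1) (λ ()) (λ ()))
    where
    -- a02 records that vertex 0 treats vertices 1 and 2 alike
    by-orientation : arc G (# 0) (# 2) ≡ arc G (# 0) (# 1) → Holds Π G
    by-orientation a02 with arc G (# 0) (# 1) in a01 | arc G (# 1) (# 2) in a12
    ... | true  | true  = transitive-triple G id a01 a12 a02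
    ... | true  | false = transitive-triple G (transpose (# 1) (# 2)) a02 (reverse-arc G tG (λ ()) a12) a01
    ... | false | true  = transitive-triple G (transpose (# 1) (# 2) ∘ₚ transpose (# 0) (# 1))
                            a12 (reverse-arc G tG (λ ()) a02) (reverse-arc G tG (λ ()) a01)
    ... | false | false = transitive-triple G (transpose (# 0) (# 2))
                            (reverse-arc G tG (λ ()) a12) (reverse-arc G tG (λ ()) a01) (reverse-arc G tG (λ ()) a02)

module Greedy (Π : GraphProperty) (SE : StronglyExtendible ½ Π) (her : Hereditary Π)
              {n : ℕ} (T : OGraph n) (tT : IsTournament T) where
  open StronglyExtendible SE
  open Extendible Π SE

  record Within (H : OGraph n) (A : VSet n) : Set where
    field
      sub   : ∀ {i j} → arc H i j ≡ true → arc T i j ≡ true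
      tail∈ : ∀ {i j} → arc H i j ≡ true → A i ≡ true
      head∈ : ∀ {i j} → arc H i j ≡ true → A j ≡ true
  open Within

  no-arc-from : ∀ {H A i j} → Within H A → A i ≡ false → arc H i j ≡ false
  no-arc-from {H} {i = i} {j} W i∉A with arc H i j in a
  ... | true  = trans (sym (tail∈ W a)) i∉A
  ... | false = refl

  no-arc-to : ∀ {H A i j} → Within H A → A j ≡ false → arc H i j ≡ false
  no-arc-to {H} {i = i} {j} W j∉A with arc H i j in a
  ... | true  = trans (sym (head∈ W a)) j∉A
  ... | false = refl

  within-sub : ∀ {H K A} → (∀ {i j} → arc K i j ≡ true → arc H i j ≡ true) → Within H A → Within K A
  within-sub K⊆H W = record { sub = sub W ∘ K⊆H ; tail∈ = tail∈ W ∘ K⊆H ; head∈ = head∈ W ∘ K⊆H }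

  Complete : OGraph n → VSet n → Set
  Complete H A = ∀ {i j} → A i ≡ true → A j ≡ true → arc H i j ≡ arc T i j

  star : VSet n → Fin n → Fin n → Fin n → Bool
  star A v i j = if ⌊ i ≟ v ⌋ then A j else (⌊ j ≟ v ⌋ ∧ A i)

  join : OGraph n → VSet n → Fin n → OGraph n
  join H A v = record
    { arc      = λ i j → arc T i j ∧ (arc H i j ∨ star A v i j)
    ; irrefl   = λ i → cong (_∧ (arc H i i ∨ star A v i i)) (irrefl T i)
    ; oriented = λ i j a → cong (_∧ (arc H j i ∨ star A v j i)) (oriented T i j (∧-elimˡ a))
    }

  module _ {H : OGraph n} {A : VSet n} {v : Fin n} (W : Within H A) (v∉A : A v ≡ false) where

    join-from : ∀ j → arc (join H A v) v j ≡ arc T v j ∧ A j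
    join-from j rewrite no-arc-from {j = j} W v∉A | single-self v = refl

    join-to : ∀ i → arc (join H A v) i v ≡ arc T i v ∧ A i
    join-to i rewrite no-arc-to {i = i} W v∉A | single-self v with i ≟ v
    ... | yes refl rewrite v∉A = refl
    ... | no _ = refl

    join-away : ∀ {i j} → i ≢ v → j ≢ v → arc (join H A v) i j ≡ arc H i j
    join-away {i} {j} i≢v j≢v rewrite single-other i≢v | single-other j≢v | ∨-identityʳ (arc H i j)
      with arc H i j in a
    ... | true  = cong (_∧ true) (sub W a)
    ... | false = ∧-zeroʳ (arc T i j)

    join-within : Within (join H A v) (insert v A)
    join-within = record { sub = ∧-elimˡ ; tail∈ = tail ; head∈ = head }
      where
      tail : ∀ {i j} → arc (join H A v) i j ≡ true → insert v A i ≡ true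
      tail {i} {j} a with toSum (i ≟ v) | toSum (j ≟ v)
      ... | inj₁ refl | _         = insert-new _ A
      ... | inj₂ _    | inj₁ refl = insert-old A (∧-elimʳ (trans (sym (join-to i)) a))
      ... | inj₂ i≢v | inj₂ j≢v = insert-old A (tail∈ W (trans (sym (join-away i≢v j≢v)) a))
      head : ∀ {i j} → arc (join H A v) i j ≡ true → insert v A j ≡ true
      head {i} {j} a with toSum (i ≟ v) | toSum (j ≟ v)
      ... | _         | inj₁ refl = insert-new _ A
      ... | inj₁ refl | inj₂ _    = insert-old A (∧-elimʳ (trans (sym (join-from j)) a))
      ... | inj₂ i≢v | inj₂ j≢v = insert-old A (head∈ W (trans (sym (join-away i≢v j≢v)) a))

    join-internal : ∀ i j → arc (join H A v) i j ∧ same (single v i) (single v j) ≡ arc H i j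
    join-internal i j with toSum (i ≟ v) | toSum (j ≟ v)
    ... | inj₁ refl | inj₁ refl = trans (cong (_∧ _) (irrefl (join H A v) v)) (sym (irrefl H v))
    ... | inj₁ refl | inj₂ j≢v  =
      trans (cong (arc (join H A v) v j ∧_) (cong₂ same (single-self v) (single-other j≢v)))
            (trans (∧-zeroʳ _) (sym (no-arc-from W v∉A)))
    ... | inj₂ i≢v  | inj₁ refl =
      trans (cong (arc (join H A v) i v ∧_) (cong₂ same (single-other i≢v) (single-self v)))
            (trans (∧-zeroʳ _) (sym (no-arc-to W v∉A)))
    ... | inj₂ i≢v  | inj₂ j≢v  =
      trans (cong (arc (join H A v) i j ∧_) (cong₂ same (single-other i≢v) (single-other j≢v)))
            (trans (∧-identityʳ _) (join-away i≢v j≢v))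

    join-adj : ∀ u → adj (join H A v) v u ≡ A u
    join-adj u rewrite join-from u | join-to u with A u in u∈A
    ... | false = cong₂ _∨_ (∧-zeroʳ (arc T v u)) (∧-zeroʳ (arc T u v))
    ... | true  = trans (cong₂ _∨_ (∧-identityʳ (arc T v u)) (∧-identityʳ (arc T u v))) (tT v u v≢u)
      where
      v≢u : v ≢ u
      v≢u refl = case trans (sym v∉A) u∈A of λ ()

    join-edges : edges (join H A v) ≡ edges H + card A
    join-edges = begin
      edges (join H A v)
        ≡⟨ edges-split (join H A v) (single v) ⟩
      countPairs (internal (join H A v) (single v)) + countPairs (crossing (join H A v) (single v))
        ≡⟨ cong₂ _+_ (countPairs-cong join-internal) (crossing-single (join H A v) v) ⟩
      edges H + degree (join H A v) v
        ≡⟨ cong (edges H +_) (trans (sumFin-cong (cong b2n ∘ join-adj)) (sym (card-sum A))) ⟩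
      edges H + card A ∎
      where open ≡-Reasoning

    join-complete : Complete H A → Complete (join H A v) (insert v A)
    join-complete complete {i} {j} i∈ j∈ with toSum (i ≟ v) | toSum (j ≟ v)
    ... | inj₁ refl | inj₁ refl = trans (irrefl (join H A v) v) (sym (irrefl T v))
    ... | inj₁ refl | inj₂ j≢v =
      trans (join-from j) (trans (cong (arc T v j ∧_) (insert-other A j∈ j≢v)) (∧-identityʳ _))
    ... | inj₂ i≢v | inj₁ refl =
      trans (join-to i) (trans (cong (arc T i v ∧_) (insert-other A i∈ i≢v)) (∧-identityʳ _))
    ... | inj₂ i≢v | inj₂ j≢v =
      trans (join-away i≢v j≢v) (complete (insert-other A i∈ i≢v) (insert-other A j∈ j≢v))

  record Added (H : OGraph n) (A : VSet n) (v : Fin n) : Set where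
    field
      K         : OGraph n
      gained    : ℕ
      within    : Within K (insert v A)
      K∈Π       : Holds Π K
      edges-K   : edges K ≡ edges H + gained
      half-kept : card A ≤ 2 * gained

  -- Adding a vertex v outside A: join v to A, cut off {v}, and let the extension
  -- property keep at least half of the |A| arcs at v.
  add-vertex : ∀ {H A v} → Within H A → Holds Π H → A v ≡ false → Added H A v
  add-vertex {H} {A} {v} W H∈Π v∉A = record
    { K = K ; gained = x ; within = within-sub ∧-elimˡ (join-within W v∉A) ; K∈Π = proj₂ (proj₂ extended)
    ; edges-K = edges-K ; half-kept = at-least-half }
    where
    G = join H A v
    -- the side {v} has no arcs, the other side is an induced subgraph of H
    single-side : Holds Π (induced G (single v))
    single-side = edgeless-induced G (single v) λ a b a∈ b∈ →
      subst₂ (λ a b → arc G a b ≡ false) (sym (single-true a∈)) (sym (single-true b∈)) (irrefl G v)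
    rest-side : Holds Π (induced G (not ∘ single v))
    rest-side = holds-induced-cong H G (not ∘ single v)
      (λ a b a∉ b∉ → join-away W v∉A (outside-single a∉) (outside-single b∉)) (her H (not ∘ single v) H∈Π)
    extended = extension G (single v) single-side rest-side
    K = keepOnly G (single v) (proj₁ extended)
    x = countPairs (keptCrossing G (single v) (proj₁ extended))
    edges-K : edges K ≡ edges H + x
    edges-K = trans (edges-keepOnly G (single v) (proj₁ extended))
                    (cong (_+ x) (countPairs-cong (join-internal W v∉A)))
    at-least-half : card A ≤ 2 * x
    at-least-half = subst (_≤ 2 * x) crossing-size
                          (Embedding.half {countPairs (crossing G (single v))} {x} (proj₁ (proj₂ extended)))
      where
      crossing-size : countPairs (crossing G (single v)) ≡ card A
      crossing-size = trans (crossing-single G v)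
                            (trans (sumFin-cong (cong b2n ∘ join-adj W v∉A)) (sym (card-sum A)))

  -- The invariant of the greedy construction: a Π-subgraph of T inside A with
  -- 4·|E(H)| + 1 ≥ |A|² + 4δ, i.e. δ edges more than the bound |A|²/4 (rounded down).
  record Greedy (δ : ℕ) (A : VSet n) : Set where
    field
      H      : OGraph n
      within : Within H A
      H∈Π    : Holds Π H
      large  : card A * card A + 4 * δ ≤ 4 * edges H + 1

  greedy-step : ∀ {δ A v} → Greedy δ A → A v ≡ false → Greedy δ (insert v A)
  greedy-step {δ} {A} {v} g v∉A = record
    { H = K ; within = Added.within added ; H∈Π = K∈Π
    ; large = subst₂ (λ c e → c * c + 4 * δ ≤ 4 * e + 1) (sym (card-insert {v = v} {A} v∉A)) (sym edges-K)
                     (greedy-arith (card A) (edges H) gained δ large half-kept)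
    }
    where
    open Greedy g
    added = add-vertex within H∈Π v∉A
    open Added added hiding (within)

  saturate : ∀ k {δ A} → card A + k ≡ n → Greedy δ A → Σ (VSet n) λ A′ → card A′ ≡ n × Greedy δ A′
  saturate zero    {A = A} size g = A , trans (sym (ℕP.+-identityʳ (card A))) size , g
  saturate (suc k) {A = A} size g with outside-vertex A
  ... | inj₁ (v , v∉A) = saturate k size′ (greedy-step {v = v} g v∉A)
    where
    size′ : card (insert v A) + k ≡ n
    size′ = trans (cong (_+ k) (card-insert {v = v} {A} v∉A)) (trans (sym (ℕP.+-suc (card A) k)) size)
  ... | inj₂ all∈A = ⊥-elim (ℕP.m+1+n≰m (card A) (ℕP.≤-reflexive (trans size (sym (card-full all∈A)))))

  greedy-bound : ∀ {δ A} (b : ℕ) → (∀ {m} (K : OGraph m) → SubgraphOf K T → Holds Π K → edges K ≤ b) →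
    Greedy δ A → n * n + 4 * δ ≤ 4 * b + 1
  greedy-bound {δ} {A} b maximal g with saturate (n ∸ card A) (ℕP.m+[n∸m]≡n (card-≤ A)) g
  ... | A′ , all , g′ = begin
    n * n + 4 * δ               ≡⟨ cong (λ c → c * c + 4 * δ) all ⟨
    card A′ * card A′ + 4 * δ   ≤⟨ large ⟩
    4 * edges H + 1             ≤⟨ ℕP.+-monoˡ-≤ 1 (ℕP.*-monoʳ-≤ 4 (maximal H as-subgraph H∈Π)) ⟩
    4 * b + 1                   ∎
    where
    open Greedy g′
    open ℕP.≤-Reasoning
    as-subgraph : SubgraphOf H T
    as-subgraph = record { f = λ i → i ; inj = λ eq → eq ; arcMap = λ i j → sub within }

  empty : OGraph n
  empty = record { arc = λ _ _ → false ; irrefl = λ _ → refl ; oriented = λ _ _ () }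

  edges-empty : edges empty ≡ 0
  edges-empty = trans (sumFin-cong {n} (λ _ → sumFin-zero n)) (sumFin-zero n)

  empty-start : Greedy 0 ∅
  empty-start = record
    { H = empty ; within = record { sub = λ () ; tail∈ = λ () ; head∈ = λ () }
    ; H∈Π = edgeless empty (λ _ _ → refl)
    ; large = subst (λ c → c * c + 0 ≤ 4 * edges empty + 1) (sym (card-∅ {n})) z≤n
    }

-- An odd tournament on at least five vertices: the greedy construction can start
-- from a transitive triangle, one edge above the bound ⌊9/4⌋ = 2.
module TripleStart (Π : GraphProperty) (SE : StronglyExtendible ½ Π) (her : Hereditary Π)
                   (tK3 : Holds Π transitiveK3) {n : ℕ} (T : OGraph (suc n)) (tT : IsTournament T) where
  open Extendible Π SE
  open Triangles Π tK3
  open Greedy Π SE her T tT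
  open Within

  -- Fix x, y ≠ 0 with x ≢ y to which 0 is joined in the same direction; then {0, x, y}
  -- spans a transitive triangle, built as three joins starting from nothing.
  module _ {x y : Fin (suc n)} (x≢0 : x ≢ zero) (y≢0 : y ≢ zero) (x≢y : x ≢ y)
           (same-side : arc T zero x ≡ arc T zero y) where

    B₁ B₂ B : VSet (suc n)
    B₁ = insert zero ∅
    B₂ = insert x B₁
    B  = insert y B₂

    x∉B₁ : B₁ x ≡ false
    x∉B₁ = insert-∉ refl x≢0
    y∉B₂ : B₂ y ≡ false
    y∉B₂ = insert-∉ {A = B₁} (insert-∉ {A = ∅} refl y≢0) (x≢y ∘ sym)

    H₁ H₂ H₃ : OGraph (suc n)
    H₁ = join empty ∅ zero
    H₂ = join H₁ B₁ x
    H₃ = join H₂ B₂ y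

    W₀ : Within empty ∅
    W₀ = record { sub = λ () ; tail∈ = λ () ; head∈ = λ () }
    W₁ : Within H₁ B₁
    W₁ = join-within W₀ refl
    W₂ : Within H₂ B₂
    W₂ = join-within W₁ x∉B₁
    W₃ : Within H₃ B
    W₃ = join-within W₂ y∉B₂

    complete : Complete H₃ B
    complete = join-complete {v = y} W₂ y∉B₂
                 (join-complete {v = x} W₁ x∉B₁ (join-complete {v = zero} W₀ refl λ ()))

    card-B₁ : card B₁ ≡ 1
    card-B₁ = trans (card-insert {suc n} {zero} {∅} refl) (cong suc (card-∅ {suc n}))
    card-B₂ : card B₂ ≡ 2
    card-B₂ = trans (card-insert {v = x} {B₁} x∉B₁) (cong suc card-B₁)
    card-B : card B ≡ 3
    card-B = trans (card-insert {v = y} {B₂} y∉B₂) (cong suc card-B₂)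

    -- 0 + |∅| + |B₁| + |B₂| = 0 + 0 + 1 + 2 arcs
    edges-H₃ : edges H₃ ≡ 3
    edges-H₃ = trans (join-edges {v = y} W₂ y∉B₂) (cong₂ _+_ edges-H₂ card-B₂)
      where
      edges-H₁ : edges H₁ ≡ 0
      edges-H₁ = trans (join-edges {v = zero} W₀ refl) (cong₂ _+_ edges-empty (card-∅ {suc n}))
      edges-H₂ : edges H₂ ≡ 1
      edges-H₂ = trans (join-edges {v = x} W₁ x∉B₁) (cong₂ _+_ edges-H₁ card-B₁)

    triple-member : ∀ {u} → B u ≡ true → u ≢ zero → u ≡ x ⊎ u ≡ y
    triple-member {u} u∈B u≢0 with insert-member B₂ u∈B
    ... | inj₂ u≡y = inj₂ u≡y
    ... | inj₁ u∈B₂ with insert-member B₁ u∈B₂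
    ...   | inj₂ u≡x  = inj₁ u≡x
    ...   | inj₁ u∈B₁ = case insert-other ∅ u∈B₁ u≢0 of λ ()

    triangle : Holds Π (induced H₃ B)
    triangle = source-or-sink-triangle (induced H₃ B) card-B tournament
      (λ a b a≢0 b≢0 → trans (toward a a≢0) (sym (toward b b≢0)))
      where
      tournament : IsTournament (induced H₃ B)
      tournament a b a≢b =
        trans (cong₂ _∨_ (complete (enum-in B a) (enum-in B b)) (complete (enum-in B b) (enum-in B a)))
              (tT _ _ (a≢b ∘ enum-injective B))
      toward : ∀ a → a ≢ zero → arc (induced H₃ B) zero a ≡ arc T zero x
      toward a a≢0 with triple-member (enum-in B a) (a≢0 ∘ enum-injective B)
      ... | inj₁ ≡x = trans (complete refl (enum-in B a)) (cong (arc T zero) ≡x)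
      ... | inj₂ ≡y = trans (complete refl (enum-in B a)) (trans (cong (arc T zero) ≡y) (sym same-side))

    -- H₃ is the triangle plus isolated vertices
    H₃∈Π : Holds Π H₃
    H₃∈Π = disjoint-union H₃ B (λ i j a → cong₂ same (tail∈ W₃ a) (head∈ W₃ a)) triangle
      (edgeless-induced H₃ (not ∘ B) (λ a b a∉B _ → no-arc-from W₃ (not-true a∉B)))

    triple-start : Greedy 1 B
    triple-start = record
      { H = H₃ ; within = W₃ ; H∈Π = H₃∈Π
      ; large = subst₂ (λ c e → c * c + 4 * 1 ≤ 4 * e + 1) (sym card-B) (sym edges-H₃) ℕP.≤-refl }

  -- two of the vertices 1, 2, 3 are joined to 0 in the same direction
  start : 3 ≤ n → ∃ (Greedy 1)
  start 3≤n =
    let (a , b , a≢b , same-dir) = pigeonhole (λ a → arc T zero (other a))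
    in _ , triple-start (λ ()) (λ ()) (a≢b ∘ inject≤-injective 3≤n 3≤n a b ∘ suc-injective) same-dir
    where
    other : Fin 3 → Fin (suc n)
    other a = suc (inject≤ a 3≤n)

square-bound : (Π : GraphProperty) → StronglyExtendible ½ Π → Hereditary Π → Holds Π transitiveK3 →
  ∀ j → 2 ≤ j → j ≢ 3 → (T : OGraph j) → IsTournament T → ∀ b →
  (∀ {m} (H : OGraph m) → SubgraphOf H T → Holds Π H → edges H ≤ b) → j * j ≤ 4 * b
square-bound Π SE her tK3 j 2≤j j≢3 T tT b maximal with even-or-odd j
... | even m            =
  let open Greedy Π SE her T tT
  in even-square m b (greedy-bound b maximal empty-start)
... | odd zero          = case 2≤j of λ { (s≤s ()) }
... | odd (suc zero)    = ⊥-elim (j≢3 refl)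
... | odd (suc (suc m)) =
  let open Greedy Π SE her T tT
      open TripleStart Π SE her tK3 T tT
      three-others : 3 ≤ suc (suc m) + suc (suc m)
      three-others = ℕP.+-mono-≤ {1} {suc (suc m)} (s≤s z≤n) (s≤s (s≤s z≤n))
  in surplus-square (suc (suc (suc m) + suc (suc m))) b (greedy-bound b maximal (proj₂ (start three-others)))

mainTheorem7 : (Π : GraphProperty) → StronglyExtendible ½ Π → Hereditary Π →
    ¬ Holds Π orientedK3 → Holds Π transitiveK3 →
    ∀ (j : ℕ) → 2 ≤ j → j ≢ 3 → ∀ (b : ℕ) → IsBetaK Π j b → 0ℚ <ℚ ex ½ j b
mainTheorem7 Π SE her _ tK3 j 2≤j j≢3 b ((T , tT , _ , maximal) , _) =
  Embedding.positive-excess j b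
    (pairs-bound j b (ℕP.≤-trans (s≤s z≤n) 2≤j) (square-bound Π SE her tK3 j 2≤j j≢3 T tT b maximal))
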